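{- Let $\ell\ge 1$ and let $C=(w_1,\dots,w_{2\ell+1})$ be distinct vertices of $\Omega_n$ with $w_1<w_3<\dots<w_{2\ell+1}<w_2<w_4<\dots<w_{2\ell}<w_1$. Then $H_n^{(2)}(C)$ consists exactly of the edges $\{w_i,w_{i+1}\}$ for $1\le i\le 2\ell+1$ together with all edges $\{v_j,w_i\}$ with $v_j\in(w_{i-1},w_{i+1})$ (indices of $w$ modulo $2\ell+1$). In particular, $H_n^{(2)}(C)$ has exactly $n$ edges.
   Context: $\Omega_n=\{v_0,\dots,v_{n-1}\}$ carries the cyclic (clockwise) order $v_0<v_1<\dots<v_{n-1}<v_0$. A chain $x_1<x_2<\dots<x_k<x_1$ of distinct points means they appear in this clockwise cyclic order. For $a,b\in\Omega_n$, $(a,b)$ is the set of points strictly between $a$ and $b$ travelling clockwise from $a$ to $b$, and $[a,b]=(a,b)\cup\{a,b\}$. For such a tuple $C$ and $r\ge 1$, $H_n^{(r)}(C)=\{e\in\binom{\Omega_n}{r}: e\cap[w_i,w_{i-1}]\neq\emptyset\text{ for all }i\in\{1,\dots,2\ell+1\}\}$, with indices of $w$ taken modulo $2\ell+1$ (so $w_0=w_{2\ell+1}$). -}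

module Defs where

open import Data.Nat using (ℕ; zero; suc; _+_; _*_; _∸_; _≤_; _<_; NonZero)
open import Data.Nat.DivMod using (_%_; m%n<n)
open import Data.Fin using (Fin; toℕ; fromℕ<)
open import Data.Product using (Σ; _×_; _,_)
open import Data.Sum using (_⊎_)
open import Relation.Binary.PropositionalEquality using (_≡_; _≢_)

-- Ω_n = Fin n, with v_j = j; clockwise order v_0 < v_1 < … < v_{n-1} < v_0.

_∈⟨_,_⟩ : ∀ {n} → Fin n → Fin n → Fin n → Set
x ∈⟨ a , b ⟩ = (toℕ a < toℕ x × toℕ x < toℕ b)
             ⊎ (toℕ b < toℕ a × (toℕ a < toℕ x ⊎ toℕ x < toℕ b))

_∈[_,_] : ∀ {n} → Fin n → Fin n → Fin n → Set
x ∈[ a , b ] = x ∈⟨ a , b ⟩ ⊎ (x ≡ a ⊎ x ≡ b)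

-- A chain x_1 < x_2 < … < x_k < x_1 (x j is x_{j+1}, 0 ≤ j < k): the points appear
-- in clockwise cyclic order, i.e. some cyclic rotation of the sequence is strictly
-- increasing in the linear order v_0 < … < v_{n-1}.
IsCyclicChain : ∀ {n} (k : ℕ) .{{_ : NonZero k}} → (ℕ → Fin n) → Set
IsCyclicChain k x = Σ ℕ λ r → ∀ i j → i < j → j < k →
  toℕ (x ((r + i) % k)) < toℕ (x ((r + j) % k))

idx : (k : ℕ) .{{_ : NonZero k}} → ℕ → Fin k
idx k m = fromℕ< (m%n<n m k)

module _ {n : ℕ} (ℓ : ℕ) (w : Fin (suc (2 * ℓ)) → Fin n) where

  K : ℕ
  K = suc (2 * ℓ)

  -- W i = w_i with indices modulo 2ℓ+1 (w zero plays the role of w_0 = w_{2ℓ+1}).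
  W : ℕ → Fin n
  W i = w (idx K i)

  -- Membership of the 2-subset {a,b} (a ≠ b) in H_n^{(2)}(C):
  -- e ∩ [w_i, w_{i-1}] ≠ ∅ for all i ∈ {1,…,2ℓ+1}.
  InH2 : Fin n → Fin n → Set
  InH2 a b = a ≢ b × (∀ i → 1 ≤ i → i ≤ K →
    (a ∈[ W i , W (i ∸ 1) ] ⊎ b ∈[ W i , W (i ∸ 1) ]))

  SamePair : Fin n → Fin n → Fin n → Fin n → Set
  SamePair a b x y = (a ≡ x × b ≡ y) ⊎ (a ≡ y × b ≡ x)

  ClaimedEdge : Fin n → Fin n → Set
  ClaimedEdge a b =
    (Σ ℕ λ i → 1 ≤ i × i ≤ K × SamePair a b (W i) (W (suc i)))
    ⊎ (Σ ℕ λ i → 1 ≤ i × i ≤ K × Σ (Fin n) λ v →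
         v ∈⟨ W (i ∸ 1) , W (suc i) ⟩ × SamePair a b v (W i))

{-# OPTIONS --safe #-}
-- List C increasingly as y 0 < ⋯ < y 2ℓ. The chain condition says that w_(k+1) lies ℓ + 1 places
-- after w_k in this list, so each [w_i, w_(i-1)] is a cyclic arc from some y q to y (q + ℓ).
-- A point of Ω_n is either a vertex y t or lies in the gap after y t, and the arcs missing it
-- are the ℓ (resp. ℓ + 1) consecutive arcs starting just after t. A pair meets every arc iff
-- these two blocks of arcs are disjoint in ℤ/(2ℓ+1), i.e. iff one of its points is the vertex
-- ℓ + 1 places after the location of the other. So x ↦ {x, y (t + ℓ + 1)} is a bijection from
-- Ω_n onto H, which therefore has n edges.
module Submission where

open import Defs
open import Data.Nat
  using (ℕ; zero; suc; pred; _*_; _+_; _∸_; _≤_; _≰_; _<_; z≤n; s≤s; s≤s⁻¹; z<s; _≤?_; _<?_; NonZero; >-nonZero⁻¹)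
open import Data.Nat.Properties
open import Data.Nat.DivMod
  using (_%_; m%n<n; m%n%n≡m%n; n%n≡0; m<n⇒m%n≡m; [m+n]%n≡m%n; [m+kn]%n≡m%n; %-distribˡ-+; %-distribˡ-*)
import Data.Nat.Tactic.RingSolver as Solver
open import Data.Fin using (Fin; toℕ)
open import Data.Fin.Properties using (toℕ-injective; fromℕ<-cong)
open import Function using (_∘_; id)
open import Data.Product using (Σ; _×_; _,_; proj₁; proj₂)
open import Data.Sum using (_⊎_; inj₁; inj₂; fromInj₂; swap)
open import Data.Empty using (⊥; ⊥-elim)
open import Data.List using (List; length; map; allFin)
open import Data.List.Properties using (length-map; length-tabulate)
open import Data.List.Relation.Unary.All as All using (All)
import Data.List.Relation.Unary.All.Properties as AllP
open import Data.List.Relation.Unary.Unique.Propositional using (Unique)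
import Data.List.Relation.Unary.Unique.Propositional.Properties as UniqueP
open import Data.List.Membership.Propositional using (_∈_)
open import Data.List.Membership.Propositional.Properties using (∈-map⁺; ∈-allFin)
open import Data.Product.Function.NonDependent.Propositional using (_×-⇔_)
open import Data.Sum.Function.Propositional using (_⊎-⇔_)
open import Function.Bundles using (_⇔_; mk⇔; Equivalence)
open import Function.Definitions using (Injective)
open import Function.Properties.Equivalence using () renaming (trans to ⇔-trans; sym to ⇔-sym)
open import Relation.Binary.Definitions using (tri<; tri≈; tri>)
open import Relation.Nullary using (yes; no; ¬_)
open import Relation.Binary.PropositionalEquality
  using (_≡_; _≢_; refl; sym; trans; cong; cong₂; subst; subst₂; module ≡-Reasoning)

[m%d+n]%d≡[m+n]%d : ∀ m n d .{{_ : NonZero d}} → (m % d + n) % d ≡ (m + n) % d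
[m%d+n]%d≡[m+n]%d m n d = begin
  (m % d + n) % d           ≡⟨ %-distribˡ-+ (m % d) n d ⟩
  (m % d % d + n % d) % d   ≡⟨ cong (λ x → (x + n % d) % d) (m%n%n≡m%n m d) ⟩
  (m % d + n % d) % d       ≡⟨ %-distribˡ-+ m n d ⟨
  (m + n) % d               ∎
  where open ≡-Reasoning

[m+n%d]%d≡[m+n]%d : ∀ m n d .{{_ : NonZero d}} → (m + n % d) % d ≡ (m + n) % d
[m+n%d]%d≡[m+n]%d m n d = begin
  (m + n % d) % d ≡⟨ cong (_% d) (+-comm m (n % d)) ⟩
  (n % d + m) % d ≡⟨ [m%d+n]%d≡[m+n]%d n m d ⟩
  (n + m) % d     ≡⟨ cong (_% d) (+-comm n m) ⟩
  (m + n) % d     ∎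
  where open ≡-Reasoning

[m*[n%d]]%d≡[m*n]%d : ∀ m n d .{{_ : NonZero d}} → (m * (n % d)) % d ≡ (m * n) % d
[m*[n%d]]%d≡[m*n]%d m n d = begin
  (m * (n % d)) % d           ≡⟨ %-distribˡ-* m (n % d) d ⟩
  (m % d * (n % d % d)) % d   ≡⟨ cong (λ x → (m % d * x) % d) (m%n%n≡m%n n d) ⟩
  (m % d * (n % d)) % d       ≡⟨ %-distribˡ-* m n d ⟨
  (m * n) % d                 ∎
  where open ≡-Reasoning

+-shift-≤ : ∀ {a b c A B} → a + c ≡ A → b + c ≡ B → a ≤ b ⇔ A ≤ B
+-shift-≤ {c = c} refl refl = mk⇔ (+-monoˡ-≤ c) (+-cancelʳ-≤ c _ _)

+-assoc-≡ : ∀ k {a c A} → a + c ≡ A → k + a + c ≡ k + A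
+-assoc-≡ k {a} {c} a+c≡A = trans (+-assoc k a c) (cong (k +_) a+c≡A)

module _ {n : ℕ} {x a b : Fin n} where

  ∈[]⇔∈⟨⟩ : x ≢ a → x ≢ b → x ∈[ a , b ] ⇔ x ∈⟨ a , b ⟩
  ∈[]⇔∈⟨⟩ x≢a x≢b = mk⇔ to inj₁
    where
    to : x ∈[ a , b ] → x ∈⟨ a , b ⟩
    to (inj₁ x∈⟨a,b⟩)   = x∈⟨a,b⟩
    to (inj₂ (inj₁ x≡a)) = ⊥-elim (x≢a x≡a)
    to (inj₂ (inj₂ x≡b)) = ⊥-elim (x≢b x≡b)

  ∈⟨⟩-cong : ∀ {P Q R : Set} → (toℕ a < toℕ x ⇔ P) → (toℕ x < toℕ b ⇔ Q) → (toℕ b < toℕ a ⇔ R) →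
             x ∈⟨ a , b ⟩ ⇔ ((P × Q) ⊎ (R × (P ⊎ Q)))
  ∈⟨⟩-cong a<x x<b b<a = (a<x ×-⇔ x<b) ⊎-⇔ (b<a ×-⇔ (a<x ⊎-⇔ x<b))

module CyclicDistance (m : ℕ) .{{_ : NonZero m}} where

  infixl 6 _⊕_
  _⊕_ : ℕ → ℕ → ℕ
  a ⊕ c = (a + c) % m

  offset : ℕ → ℕ → ℕ
  offset a b = (b + (m ∸ a)) % m

  offset<m : ∀ a b → offset a b < m
  offset<m a b = m%n<n (b + (m ∸ a)) m

  offset-spec : ∀ {a} b → a ≤ m → (a + offset a b) % m ≡ b % m
  offset-spec {a} b a≤m = begin
    (a + (b + (m ∸ a)) % m) % m ≡⟨ [m+n%d]%d≡[m+n]%d a (b + (m ∸ a)) m ⟩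
    (a + (b + (m ∸ a))) % m     ≡⟨ cong (_% m) (trans (+-comm a _) (+-assoc b (m ∸ a) a)) ⟩
    (b + ((m ∸ a) + a)) % m     ≡⟨ cong (λ x → (b + x) % m) (m∸n+n≡m a≤m) ⟩
    (b + m) % m                 ≡⟨ [m+n]%n≡m%n b m ⟩
    b % m                       ∎
    where open ≡-Reasoning

  offset-unique : ∀ {a b t} → a ≤ m → t < m → (a + t) % m ≡ b % m → offset a b ≡ t
  offset-unique {a} {b} {t} a≤m t<m a+t≈b = begin
    (b + (m ∸ a)) % m           ≡⟨ [m%d+n]%d≡[m+n]%d b (m ∸ a) m ⟨
    (b % m + (m ∸ a)) % m       ≡⟨ cong (λ x → (x + (m ∸ a)) % m) a+t≈b ⟨
    ((a + t) % m + (m ∸ a)) % m ≡⟨ [m%d+n]%d≡[m+n]%d (a + t) (m ∸ a) m ⟩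
    (a + t + (m ∸ a)) % m       ≡⟨ cong (λ x → (x + (m ∸ a)) % m) (+-comm a t) ⟩
    (t + a + (m ∸ a)) % m       ≡⟨ cong (_% m) (+-assoc t a (m ∸ a)) ⟩
    (t + (a + (m ∸ a))) % m     ≡⟨ cong (λ x → (t + x) % m) (m+[n∸m]≡n a≤m) ⟩
    (t + m) % m                 ≡⟨ [m+n]%n≡m%n t m ⟩
    t % m                       ≡⟨ m<n⇒m%n≡m t<m ⟩
    t                           ∎
    where open ≡-Reasoning

  offset-self : ∀ {a} → a ≤ m → offset a a ≡ 0
  offset-self {a} a≤m = offset-unique a≤m (>-nonZero⁻¹ m) (cong (_% m) (+-identityʳ a))

  offset-⊕ : ∀ {a} c → a ≤ m → offset a (a ⊕ c) ≡ c % m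
  offset-⊕ {a} c a≤m = offset-unique a≤m (m%n<n c m)
    (trans ([m+n%d]%d≡[m+n]%d a c m) (sym (m%n%n≡m%n (a + c) m)))

  ⊕-offset : ∀ {a b} → a ≤ m → b < m → a ⊕ offset a b ≡ b
  ⊕-offset {a} {b} a≤m b<m = trans (offset-spec b a≤m) (m<n⇒m%n≡m b<m)

  offset-% : ∀ a b → offset a (b % m) ≡ offset a b
  offset-% a b = [m%d+n]%d≡[m+n]%d b (m ∸ a) m

  offset-+ʳ : ∀ {a} b c → a ≤ m → offset a (b + c) ≡ offset a b ⊕ c
  offset-+ʳ {a} b c a≤m = offset-unique a≤m (m%n<n (offset a b + c) m) (begin
    (a + (offset a b + c) % m) % m ≡⟨ [m+n%d]%d≡[m+n]%d a (offset a b + c) m ⟩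
    (a + (offset a b + c)) % m     ≡⟨ cong (_% m) (+-assoc a (offset a b) c) ⟨
    (a + offset a b + c) % m       ≡⟨ [m%d+n]%d≡[m+n]%d (a + offset a b) c m ⟨
    ((a + offset a b) % m + c) % m ≡⟨ cong (λ x → (x + c) % m) (offset-spec b a≤m) ⟩
    (b % m + c) % m                ≡⟨ [m%d+n]%d≡[m+n]%d b c m ⟩
    (b + c) % m                    ∎)
    where open ≡-Reasoning

  offset-⊕ˡ : ∀ {a c} b → a ≤ m → c ≤ m → offset (a ⊕ c) b ≡ offset c (offset a b)
  offset-⊕ˡ {a} {c} b a≤m c≤m = offset-unique (<⇒≤ (m%n<n (a + c) m)) (offset<m c _) (begin
    ((a + c) % m + t) % m ≡⟨ [m%d+n]%d≡[m+n]%d (a + c) t m ⟩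
    (a + c + t) % m       ≡⟨ cong (_% m) (+-assoc a c t) ⟩
    (a + (c + t)) % m     ≡⟨ [m+n%d]%d≡[m+n]%d a (c + t) m ⟨
    (a + (c + t) % m) % m ≡⟨ cong (λ x → (a + x) % m) (offset-spec (offset a b) c≤m) ⟩
    (a + offset a b % m) % m ≡⟨ [m+n%d]%d≡[m+n]%d a (offset a b) m ⟩
    (a + offset a b) % m  ≡⟨ offset-spec b a≤m ⟩
    b % m                 ∎)
    where
    open ≡-Reasoning
    t = offset c (offset a b)

  offset+≡ : ∀ {a b} → a ≤ b → b < m → offset a b + a ≡ b
  offset+≡ {a} {b} a≤b b<m = begin
    offset a b + a ≡⟨ cong (_+ a) (offset-unique (≤-trans a≤b (<⇒≤ b<m)) (≤-<-trans (m∸n≤m b a) b<m)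
                                     (cong (_% m) (m+[n∸m]≡n a≤b))) ⟩
    (b ∸ a) + a    ≡⟨ m∸n+n≡m a≤b ⟩
    b              ∎
    where open ≡-Reasoning

  offset+≡+m : ∀ {a b} → b < a → a ≤ m → offset a b + a ≡ b + m
  offset+≡+m {a} {b} b<a a≤m = begin
    offset a b + a   ≡⟨ cong (_+ a) (offset-unique a≤m t<m
                                          (trans (cong (_% m) (m+[n∸m]≡n a≤b+m)) ([m+n]%n≡m%n b m))) ⟩
    (b + m ∸ a) + a  ≡⟨ m∸n+n≡m a≤b+m ⟩
    b + m            ∎
    where
    open ≡-Reasoning
    a≤b+m : a ≤ b + m
    a≤b+m = ≤-trans a≤m (m≤n+m m b)
    t<m : b + m ∸ a < m
    t<m = subst (b + m ∸ a <_) (m+n∸m≡n a m) (∸-monoˡ-< (+-monoˡ-< m b<a) a≤b+m)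

  ⊕-assoc : ∀ a b c → a ⊕ b ⊕ c ≡ a ⊕ (b + c)
  ⊕-assoc a b c = trans ([m%d+n]%d≡[m+n]%d (a + b) c m) (cong (_% m) (+-assoc a b c))

  a⊕c≡a⇒c%m≡0 : ∀ {a} c → a ≤ m → a ⊕ c ≡ a → c % m ≡ 0
  a⊕c≡a⇒c%m≡0 {a} c a≤m a⊕c≡a = trans (sym (offset-⊕ c a≤m)) (trans (cong (offset a) a⊕c≡a) (offset-self a≤m))

  -- j lies on the clockwise walk from p to s, and so does j + 1 when κ = 1.
  Between : ℕ → ℕ → ℕ → ℕ → Set
  Between p s κ j = (p ≤ j × κ + j ≤ s) ⊎ (s < p × (p ≤ j ⊎ κ + j ≤ s))

  between⇔offset : ∀ {p s κ j} → κ ≤ 1 → p < m → s < m → j < m →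
                   Between p s κ j ⇔ κ + offset p j ≤ offset p s
  between⇔offset {p} {s} {κ} {j} κ≤1 p<m s<m j<m with p ≤? j | p ≤? s
  ... | yes p≤j | yes p≤s =
    ⇔-trans (mk⇔ to from) (⇔-sym (+-shift-≤ (+-assoc-≡ κ (offset+≡ p≤j j<m)) (offset+≡ p≤s s<m)))
    where
    to : Between p s κ j → κ + j ≤ s
    to (inj₁ (_ , κ+j≤s)) = κ+j≤s
    to (inj₂ (s<p , _))   = ⊥-elim (<⇒≱ s<p p≤s)
    from : κ + j ≤ s → Between p s κ j
    from κ+j≤s = inj₁ (p≤j , κ+j≤s)
  ... | yes p≤j | no p≰s = mk⇔ (λ _ → Equivalence.from shifted κ+j≤s+m) (λ _ → inj₂ (≰⇒> p≰s , inj₁ p≤j))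
    where
    shifted = +-shift-≤ (+-assoc-≡ κ (offset+≡ p≤j j<m)) (offset+≡+m (≰⇒> p≰s) (<⇒≤ p<m))
    κ+j≤s+m : κ + j ≤ s + m
    κ+j≤s+m = ≤-trans (+-monoˡ-≤ j κ≤1) (≤-trans j<m (m≤n+m m s))
  ... | no p≰j | yes p≤s = mk⇔ to from
    where
    to : Between p s κ j → κ + offset p j ≤ offset p s
    to (inj₁ (p≤j , _)) = ⊥-elim (p≰j p≤j)
    to (inj₂ (s<p , _)) = ⊥-elim (<⇒≱ s<p p≤s)
    shifted = +-shift-≤ (+-assoc-≡ κ (offset+≡+m (≰⇒> p≰j) (<⇒≤ p<m))) (offset+≡ p≤s s<m)
    from : κ + offset p j ≤ offset p s → Between p s κ j
    from le = ⊥-elim (<⇒≱ (≤-trans s<m (m≤n+m m (κ + j)))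
                          (subst (_≤ s) (sym (+-assoc κ j m)) (Equivalence.to shifted le)))
  ... | no p≰j | no p≰s =
    ⇔-trans (mk⇔ to from)
      (⇔-trans (+-shift-≤ (+-assoc κ j m) refl)
               (⇔-sym (+-shift-≤ (+-assoc-≡ κ (offset+≡+m (≰⇒> p≰j) (<⇒≤ p<m)))
                                 (offset+≡+m (≰⇒> p≰s) (<⇒≤ p<m)))))
    where
    to : Between p s κ j → κ + j ≤ s
    to (inj₁ (p≤j , _))        = ⊥-elim (p≰j p≤j)
    to (inj₂ (_ , inj₁ p≤j))   = ⊥-elim (p≰j p≤j)
    to (inj₂ (_ , inj₂ κ+j≤s)) = κ+j≤s
    from : κ + j ≤ s → Between p s κ j
    from κ+j≤s = inj₂ (≰⇒> p≰s , inj₂ κ+j≤s)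

  between-start : ∀ {p s} → Between p s 0 p
  between-start {p} {s} with p ≤? s
  ... | yes p≤s = inj₁ (≤-refl , p≤s)
  ... | no p≰s  = inj₂ (≰⇒> p≰s , inj₁ ≤-refl)

  between-end : ∀ {p s} → Between p s 0 s
  between-end {p} {s} with p ≤? s
  ... | yes p≤s = inj₁ (p≤s , ≤-refl)
  ... | no p≰s  = inj₂ (≰⇒> p≰s , inj₂ ≤-refl)

-- A point of Ω_n lies on a vertex of C or in the gap after one. A gap point lies in an arc only
-- if the arc also contains the next vertex, whence the extra unit of weight.
data Kind : Set where
  point gap : Kind

weight : Kind → ℕ
weight point = 0
weight gap   = 1

weight≤1 : ∀ κ → weight κ ≤ 1
weight≤1 point = z≤n
weight≤1 gap   = s≤s z≤n

module OddCycle (ℓ : ℕ) (1≤ℓ : 1 ≤ ℓ) where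

  2ℓ+1 : ℕ
  2ℓ+1 = suc (2 * ℓ)

  open CyclicDistance 2ℓ+1 public

  ℓ+[1+ℓ]≡2ℓ+1 : ℓ + suc ℓ ≡ 2ℓ+1
  ℓ+[1+ℓ]≡2ℓ+1 = trans (+-suc ℓ ℓ) (cong (λ k → suc (ℓ + k)) (sym (+-identityʳ ℓ)))

  ℓ<2ℓ+1 : ℓ < 2ℓ+1
  ℓ<2ℓ+1 = subst (ℓ <_) ℓ+[1+ℓ]≡2ℓ+1 (m<m+n ℓ z<s)

  1+ℓ<2ℓ+1 : suc ℓ < 2ℓ+1
  1+ℓ<2ℓ+1 = subst (suc ℓ <_) (trans (+-comm (suc ℓ) ℓ) ℓ+[1+ℓ]≡2ℓ+1) (m<m+n (suc ℓ) 1≤ℓ)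

  offset-⊕ℓ : ∀ {q} → q ≤ 2ℓ+1 → offset q (q ⊕ ℓ) ≡ ℓ
  offset-⊕ℓ q≤ = trans (offset-⊕ ℓ q≤) (m<n⇒m%n≡m ℓ<2ℓ+1)

  ⊕ℓ⊕[1+ℓ] : ∀ {t} → t < 2ℓ+1 → t ⊕ ℓ ⊕ suc ℓ ≡ t
  ⊕ℓ⊕[1+ℓ] {t} t< = trans (⊕-assoc t ℓ (suc ℓ))
    (trans (cong (λ c → (t + c) % 2ℓ+1) ℓ+[1+ℓ]≡2ℓ+1) (trans ([m+n]%n≡m%n t 2ℓ+1) (m<n⇒m%n≡m t<)))

  ⊕[1+ℓ]⊕ℓ : ∀ {t} → t < 2ℓ+1 → t ⊕ suc ℓ ⊕ ℓ ≡ t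
  ⊕[1+ℓ]⊕ℓ {t} t< = trans (⊕-assoc t (suc ℓ) ℓ)
    (trans (cong (λ c → (t + c) % 2ℓ+1) (+-comm (suc ℓ) ℓ)) (trans (sym (⊕-assoc t ℓ (suc ℓ))) (⊕ℓ⊕[1+ℓ] t<)))

  ⊕[1+ℓ]≢ : ∀ {t} → t < 2ℓ+1 → t ⊕ suc ℓ ≢ t
  ⊕[1+ℓ]≢ t< eq = 1+n≢0 (trans (sym (m<n⇒m%n≡m 1+ℓ<2ℓ+1)) (a⊕c≡a⇒c%m≡0 (suc ℓ) (<⇒≤ t<) eq))

  ⊕[1+ℓ]⊕[1+ℓ] : ∀ t → t ⊕ suc ℓ ⊕ suc ℓ ≡ t ⊕ 1
  ⊕[1+ℓ]⊕[1+ℓ] t = begin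
    t ⊕ suc ℓ ⊕ suc ℓ            ≡⟨ ⊕-assoc t (suc ℓ) (suc ℓ) ⟩
    (t + (suc ℓ + suc ℓ)) % 2ℓ+1 ≡⟨ cong (λ c → (t + c) % 2ℓ+1) (two-steps ℓ) ⟩
    (t + (1 + 2ℓ+1)) % 2ℓ+1      ≡⟨ cong (_% 2ℓ+1) (+-assoc t 1 2ℓ+1) ⟨
    (t + 1 + 2ℓ+1) % 2ℓ+1        ≡⟨ [m+n]%n≡m%n (t + 1) 2ℓ+1 ⟩
    t ⊕ 1                        ∎
    where
    open ≡-Reasoning
    two-steps : ∀ ℓ → suc ℓ + suc ℓ ≡ 1 + suc (2 * ℓ)
    two-steps = Solver.solve-∀

  ⊕1≢ : ∀ {t} → t < 2ℓ+1 → t ⊕ 1 ≢ t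
  ⊕1≢ t< eq = 1+n≢0 (trans (sym (m<n⇒m%n≡m (≤-<-trans 1≤ℓ ℓ<2ℓ+1))) (a⊕c≡a⇒c%m≡0 1 (<⇒≤ t<) eq))

  κ+ℓ<2ℓ+1 : ∀ {κ} → κ ≤ 1 → κ + ℓ < 2ℓ+1
  κ+ℓ<2ℓ+1 κ≤1 = ≤-<-trans (+-monoˡ-≤ ℓ κ≤1) 1+ℓ<2ℓ+1

  offset-covers : ∀ {q} s → q ≤ 2ℓ+1 → offset q s < ℓ ⊎ offset q (s ⊕ suc ℓ) ≤ ℓ
  offset-covers {q} s q≤ with offset q s <? ℓ
  ... | yes e<ℓ = inj₁ e<ℓ
  ... | no e≮ℓ  = inj₂ (subst (_≤ ℓ) (sym (trans (offset-% q (s + suc ℓ)) (offset-+ʳ s (suc ℓ) q≤)))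
                             (wrap (≮⇒≥ e≮ℓ) (offset<m q s)))
    where
    wrap : ∀ {e} → ℓ ≤ e → e < 2ℓ+1 → e ⊕ suc ℓ ≤ ℓ
    wrap ℓ≤e e< with m≤n⇒∃[o]m+o≡n ℓ≤e
    ... | f , refl =
      subst (_≤ ℓ) (sym f≡) (s≤s⁻¹ (+-cancelˡ-< ℓ f (suc ℓ) (subst (ℓ + f <_) (sym ℓ+[1+ℓ]≡2ℓ+1) e<)))
      where
      rearrange : ∀ ℓ f → ℓ + f + suc ℓ ≡ f + suc (2 * ℓ)
      rearrange = Solver.solve-∀
      f≡ : (ℓ + f + suc ℓ) % 2ℓ+1 ≡ f
      f≡ = trans (cong (_% 2ℓ+1) (rearrange ℓ f))
                 (trans ([m+n]%n≡m%n f 2ℓ+1) (m<n⇒m%n≡m (≤-<-trans (m≤n+m f ℓ) e<)))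

  κ+offset[c,0]≰ℓ : ∀ {κ c} → κ ≤ 1 → 1 ≤ c → c ≤ κ + ℓ → κ + offset c 0 ≰ ℓ
  κ+offset[c,0]≰ℓ {κ} {c} κ≤1 1≤c c≤κ+ℓ κ+o≤ℓ = <-irrefl refl (subst (_≤ ℓ + (κ + ℓ)) (rearrange κ ℓ) bound)
    where
    rearrange : ∀ κ ℓ → κ + suc (2 * ℓ) ≡ suc (ℓ + (κ + ℓ))
    rearrange = Solver.solve-∀
    bound : κ + 2ℓ+1 ≤ ℓ + (κ + ℓ)
    bound = subst (_≤ ℓ + (κ + ℓ)) (+-assoc-≡ κ (offset+≡+m 1≤c (≤-trans c≤κ+ℓ (<⇒≤ (κ+ℓ<2ℓ+1 κ≤1)))))
                  (+-mono-≤ κ+o≤ℓ c≤κ+ℓ)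

  meeting-offset : ∀ κ μ {u} → u < 2ℓ+1 →
                   weight μ + offset 1 u ≤ ℓ → weight μ + offset (weight κ + ℓ) u ≤ ℓ →
                   (u ≡ suc ℓ × μ ≡ point) ⊎ (u ≡ ℓ × κ ≡ point)
  meeting-offset κ μ {zero} _ h₁ _ =
    ⊥-elim (κ+offset[c,0]≰ℓ (weight≤1 μ) ≤-refl (≤-trans 1≤ℓ (m≤n+m ℓ (weight μ))) h₁)
  meeting-offset κ μ {u@(suc _)} u< h₁ h₂ = classify κ μ κ+ℓ≤u μ+u≤1+ℓ
    where
    μ+u≤1+ℓ : weight μ + u ≤ suc ℓ
    μ+u≤1+ℓ = subst (weight μ + u ≤_) (+-comm ℓ 1)
      (Equivalence.to (+-shift-≤ (+-assoc-≡ (weight μ) (offset+≡ (s≤s z≤n) u<)) refl) h₁)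
    κ+ℓ≤u : weight κ + ℓ ≤ u
    κ+ℓ≤u with weight κ + ℓ ≤? u
    ... | yes κ+ℓ≤u = κ+ℓ≤u
    ... | no κ+ℓ≰u  = ⊥-elim (<-irrefl refl (begin-strict
      2ℓ+1                    <⟨ m<n+m 2ℓ+1 (s≤s z≤n) ⟩
      u + 2ℓ+1                ≤⟨ m≤n+m (u + 2ℓ+1) (weight μ) ⟩
      weight μ + (u + 2ℓ+1)   ≡⟨ +-assoc-≡ (weight μ) (offset+≡+m (≰⇒> κ+ℓ≰u) (<⇒≤ κ+ℓ<)) ⟨
      weight μ + offset (weight κ + ℓ) u + (weight κ + ℓ) ≤⟨ +-mono-≤ h₂ (+-monoˡ-≤ ℓ (weight≤1 κ)) ⟩
      ℓ + suc ℓ               ≡⟨ ℓ+[1+ℓ]≡2ℓ+1 ⟩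
      2ℓ+1                    ∎))
      where
      open ≤-Reasoning
      κ+ℓ< = κ+ℓ<2ℓ+1 (weight≤1 κ)
    classify : ∀ κ μ → weight κ + ℓ ≤ u → weight μ + u ≤ suc ℓ →
               (u ≡ suc ℓ × μ ≡ point) ⊎ (u ≡ ℓ × κ ≡ point)
    classify point point ℓ≤u u≤1+ℓ with m≤n⇒m<n∨m≡n ℓ≤u
    ... | inj₁ ℓ<u = inj₁ (≤-antisym u≤1+ℓ ℓ<u , refl)
    ... | inj₂ ℓ≡u = inj₂ (sym ℓ≡u , refl)
    classify gap   point 1+ℓ≤u u≤1+ℓ   = inj₁ (≤-antisym u≤1+ℓ 1+ℓ≤u , refl)
    classify point gap   ℓ≤u   1+u≤1+ℓ = inj₂ (≤-antisym (s≤s⁻¹ 1+u≤1+ℓ) ℓ≤u , refl)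
    classify gap   gap   1+ℓ≤u 1+u≤1+ℓ = ⊥-elim (<-irrefl refl (≤-trans 1+ℓ≤u (s≤s⁻¹ 1+u≤1+ℓ)))

module SortedPoints {n : ℕ} (m : ℕ) .{{_ : NonZero m}} (y : ℕ → Fin n)
                    (y-increasing : ∀ i j → i < j → j < m → toℕ (y i) < toℕ (y j)) where

  open CyclicDistance m

  y-mono-< : ∀ {i j} → i < j → j < m → toℕ (y i) < toℕ (y j)
  y-mono-< {i} {j} = y-increasing i j

  y-mono-≤ : ∀ {i j} → i ≤ j → j < m → toℕ (y i) ≤ toℕ (y j)
  y-mono-≤ i≤j j<m with m≤n⇒m<n∨m≡n i≤j
  ... | inj₁ i<j  = <⇒≤ (y-mono-< i<j j<m)
  ... | inj₂ refl = ≤-refl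

  y-cancel-< : ∀ {i j} → i < m → toℕ (y i) < toℕ (y j) → i < j
  y-cancel-< {i} {j} i<m yi<yj with i <? j
  ... | yes i<j = i<j
  ... | no i≮j  = ⊥-elim (<⇒≱ yi<yj (y-mono-≤ (≮⇒≥ i≮j) i<m))

  y-<⇔ : ∀ {i j} → i < m → j < m → toℕ (y i) < toℕ (y j) ⇔ i < j
  y-<⇔ i<m j<m = mk⇔ (y-cancel-< i<m) (λ i<j → y-mono-< i<j j<m)

  y-injective : ∀ {i j} → i < m → j < m → y i ≡ y j → i ≡ j
  y-injective {i} {j} i<m j<m yi≡yj with <-cmp i j
  ... | tri< i<j _ _ = ⊥-elim (<-irrefl (cong toℕ yi≡yj) (y-mono-< i<j j<m))
  ... | tri≈ _ i≡j _ = i≡j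
  ... | tri> _ _ j<i = ⊥-elim (<-irrefl (cong toℕ (sym yi≡yj)) (y-mono-< j<i i<m))

  InnerGap LastGap Gap : ℕ → Fin n → Set
  InnerGap g x = suc g < m × toℕ (y g) < toℕ x × toℕ x < toℕ (y (suc g))
  LastGap  g x = suc g ≡ m × (toℕ (y g) < toℕ x ⊎ toℕ x < toℕ (y 0))
  Gap      g x = InnerGap g x ⊎ LastGap g x

  gap-index<m : ∀ {g x} → Gap g x → g < m
  gap-index<m (inj₁ (1+g<m , _))  = <-trans (n<1+n _) 1+g<m
  gap-index<m (inj₂ (1+g≡m , _)) = subst (_ <_) 1+g≡m (n<1+n _)

  gap≢y : ∀ {g x p} → Gap g x → p < m → x ≢ y p
  gap≢y G@(inj₁ (_ , yg<x , x<y[1+g])) p<m refl =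
    <-irrefl refl (<-≤-trans (y-cancel-< (gap-index<m G) yg<x) (s≤s⁻¹ (y-cancel-< p<m x<y[1+g])))
  gap≢y G@(inj₂ (1+g≡m , inj₁ yg<x)) p<m refl =
    <⇒≱ (y-cancel-< (gap-index<m G) yg<x) (s≤s⁻¹ (subst (_ <_) (sym 1+g≡m) p<m))
  gap≢y (inj₂ (_ , inj₂ x<y0)) p<m refl = n≮0 (y-cancel-< p<m x<y0)

  inner-last-disjoint : ∀ {g g' x} → InnerGap g x → LastGap g' x → ⊥
  inner-last-disjoint (1+g<m , _ , x<y[1+g]) L@(1+g'≡m , inj₁ yg'<x) =
    <⇒≱ (subst (_ <_) (sym 1+g'≡m) 1+g<m) (y-cancel-< (gap-index<m (inj₂ L)) (<-trans yg'<x x<y[1+g]))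
  inner-last-disjoint I@(_ , yg<x , _) (_ , inj₂ x<y0) =
    n≮0 (y-cancel-< (gap-index<m (inj₁ I)) (<-trans yg<x x<y0))

  gap-unique : ∀ {g g' x} → Gap g x → Gap g' x → g ≡ g'
  gap-unique G@(inj₁ (_ , yg<x , x<y[1+g])) G'@(inj₁ (_ , yg'<x , x<y[1+g'])) = ≤-antisym
    (s≤s⁻¹ (y-cancel-< (gap-index<m G) (<-trans yg<x x<y[1+g'])))
    (s≤s⁻¹ (y-cancel-< (gap-index<m G') (<-trans yg'<x x<y[1+g])))
  gap-unique (inj₁ I) (inj₂ L) = ⊥-elim (inner-last-disjoint I L)
  gap-unique (inj₂ L) (inj₁ I) = ⊥-elim (inner-last-disjoint I L)
  gap-unique (inj₂ (1+g≡m , _)) (inj₂ (1+g'≡m , _)) = suc-injective (trans 1+g≡m (sym 1+g'≡m))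

  At : Kind → ℕ → Fin n → Set
  At point j x = x ≡ y j
  At gap   g x = Gap g x

  record Location (x : Fin n) : Set where
    constructor location
    field
      kind    : Kind
      index   : ℕ
      index<m : index < m
      at      : At kind index x

  locate : ∀ x → Location x
  locate x with toℕ x <? toℕ (y 0)
  ... | yes x<y0 = location gap (pred m) (m≤pred[n]⇒suc[m]≤n ≤-refl) (inj₂ (suc-pred m , inj₂ x<y0))
  ... | no x≮y0  = scan (pred m) 0 (trans (cong suc (+-identityʳ _)) (suc-pred m)) (≮⇒≥ x≮y0)
    where
    scan : ∀ k j → suc (k + j) ≡ m → toℕ (y j) ≤ toℕ x → Location x
    scan k j 1+k+j≡m yj≤x with toℕ x ≟ toℕ (y j)
    ... | yes x≡yj = location point j j<m (toℕ-injective x≡yj)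
      where j<m = subst (j <_) 1+k+j≡m (s≤s (m≤n+m j k))
    scan zero j 1+j≡m yj≤x | no x≢yj =
      location gap j (subst (j <_) 1+j≡m (n<1+n j)) (inj₂ (1+j≡m , inj₁ (≤∧≢⇒< yj≤x (x≢yj ∘ sym))))
    scan (suc k) j 1+k+j≡m yj≤x | no x≢yj with toℕ x <? toℕ (y (suc j))
    ... | yes x<y[1+j] =
      location gap j (<-trans (n<1+n j) 1+j<m) (inj₁ (1+j<m , ≤∧≢⇒< yj≤x (x≢yj ∘ sym) , x<y[1+j]))
      where 1+j<m = subst (suc j <_) 1+k+j≡m (s≤s (s≤s (m≤n+m j k)))
    ... | no x≮y[1+j]  = scan k (suc j) (trans (cong suc (+-suc k j)) 1+k+j≡m) (≮⇒≥ x≮y[1+j])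

  at-unique : ∀ {κ κ' t t' x} → t < m → t' < m → At κ t x → At κ' t' x → κ ≡ κ' × t ≡ t'
  at-unique {point} {point} t<m t'<m refl x≡yt' = refl , y-injective t<m t'<m x≡yt'
  at-unique {point} {gap}   t<m _ refl G' = ⊥-elim (gap≢y G' t<m refl)
  at-unique {gap}   {point} _ t'<m G refl = ⊥-elim (gap≢y G t'<m refl)
  at-unique {gap}   {gap}   _ _ G G' = refl , gap-unique G G'

  y∈[]⇔ : ∀ {j p s} → j < m → p < m → s < m → y j ∈[ y p , y s ] ⇔ Between p s 0 j
  y∈[]⇔ {j} {p} {s} j<m p<m s<m = mk⇔ to from
    where
    to : y j ∈[ y p , y s ] → Between p s 0 j
    to (inj₁ (inj₁ (yp<yj , yj<ys)))        = inj₁ (<⇒≤ (y-cancel-< p<m yp<yj) , <⇒≤ (y-cancel-< j<m yj<ys))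
    to (inj₁ (inj₂ (ys<yp , inj₁ yp<yj)))   = inj₂ (y-cancel-< s<m ys<yp , inj₁ (<⇒≤ (y-cancel-< p<m yp<yj)))
    to (inj₁ (inj₂ (ys<yp , inj₂ yj<ys)))   = inj₂ (y-cancel-< s<m ys<yp , inj₂ (<⇒≤ (y-cancel-< j<m yj<ys)))
    to (inj₂ (inj₁ yj≡yp)) = subst (Between p s 0) (sym (y-injective j<m p<m yj≡yp)) between-start
    to (inj₂ (inj₂ yj≡ys)) = subst (Between p s 0) (sym (y-injective j<m s<m yj≡ys)) between-end
    from : Between p s 0 j → y j ∈[ y p , y s ]
    from (inj₁ (p≤j , j≤s)) with m≤n⇒m<n∨m≡n p≤j | m≤n⇒m<n∨m≡n j≤s
    ... | inj₂ refl | _         = inj₂ (inj₁ refl)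
    ... | inj₁ _    | inj₂ refl = inj₂ (inj₂ refl)
    ... | inj₁ p<j  | inj₁ j<s  = inj₁ (inj₁ (y-mono-< p<j j<m , y-mono-< j<s s<m))
    from (inj₂ (s<p , inj₁ p≤j)) with m≤n⇒m<n∨m≡n p≤j
    ... | inj₂ refl = inj₂ (inj₁ refl)
    ... | inj₁ p<j  = inj₁ (inj₂ (y-mono-< s<p p<m , inj₁ (y-mono-< p<j j<m)))
    from (inj₂ (s<p , inj₂ j≤s)) with m≤n⇒m<n∨m≡n j≤s
    ... | inj₂ refl = inj₂ (inj₂ refl)
    ... | inj₁ j<s  = inj₁ (inj₂ (y-mono-< s<p p<m , inj₂ (y-mono-< j<s s<m)))

  inner-gap∈⟨⟩⇔ : ∀ {g x p s} → InnerGap g x → p < m → s < m → x ∈⟨ y p , y s ⟩ ⇔ Between p s 1 g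
  inner-gap∈⟨⟩⇔ {g} {x} {p} {s} I@(_ , yg<x , x<y[1+g]) p<m s<m = ∈⟨⟩-cong below above (y-<⇔ s<m p<m)
    where
    g<m = gap-index<m (inj₁ I)
    below : toℕ (y p) < toℕ x ⇔ p ≤ g
    below = mk⇔ (λ yp<x → s≤s⁻¹ (y-cancel-< p<m (<-trans yp<x x<y[1+g])))
                (λ p≤g → ≤-<-trans (y-mono-≤ p≤g g<m) yg<x)
    above : toℕ x < toℕ (y s) ⇔ g < s
    above = mk⇔ (λ x<ys → y-cancel-< g<m (<-trans yg<x x<ys))
                (λ g<s → <-≤-trans x<y[1+g] (y-mono-≤ g<s s<m))

  last-gap∈⟨⟩⇔ : ∀ {g x p s} → LastGap g x → p < m → s < m → x ∈⟨ y p , y s ⟩ ⇔ Between p s 1 g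
  last-gap∈⟨⟩⇔ {g} {x} {p} {s} L@(1+g≡m , side) p<m s<m =
    ⇔-trans (mk⇔ (to side) (from side)) (⇔-sym between⇔s<p)
    where
    g<m = gap-index<m (inj₂ L)
    ≤g : ∀ {i} → i < m → i ≤ g
    ≤g i<m = s≤s⁻¹ (subst (_ <_) (sym 1+g≡m) i<m)
    between⇔s<p : Between p s 1 g ⇔ s < p
    between⇔s<p = mk⇔ (λ { (inj₁ (_ , g<s)) → ⊥-elim (<⇒≱ g<s (≤g s<m)) ; (inj₂ (s<p , _)) → s<p })
                      (λ s<p → inj₂ (s<p , inj₁ (≤g p<m)))
    Side = toℕ (y g) < toℕ x ⊎ toℕ x < toℕ (y 0)
    to : Side → x ∈⟨ y p , y s ⟩ → s < p
    to _           (inj₂ (ys<yp , _))   = y-cancel-< s<m ys<yp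
    to (inj₁ yg<x) (inj₁ (_ , x<ys))    = ⊥-elim (<⇒≱ (y-cancel-< g<m (<-trans yg<x x<ys)) (≤g s<m))
    to (inj₂ x<y0) (inj₁ (yp<x , _))    = ⊥-elim (n≮0 (y-cancel-< p<m (<-trans yp<x x<y0)))
    from : Side → s < p → x ∈⟨ y p , y s ⟩
    from (inj₁ yg<x) s<p = inj₂ (y-mono-< s<p p<m , inj₁ (≤-<-trans (y-mono-≤ (≤g p<m) g<m) yg<x))
    from (inj₂ x<y0) s<p = inj₂ (y-mono-< s<p p<m , inj₂ (<-≤-trans x<y0 (y-mono-≤ z≤n s<m)))

  gap∈[]⇔ : ∀ {g x p s} → Gap g x → p < m → s < m → x ∈[ y p , y s ] ⇔ Between p s 1 g
  gap∈[]⇔ G p<m s<m = ⇔-trans (∈[]⇔∈⟨⟩ (gap≢y G p<m) (gap≢y G s<m)) (gap∈⟨⟩⇔ G)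
    where
    gap∈⟨⟩⇔ : Gap _ _ → _ ∈⟨ y _ , y _ ⟩ ⇔ Between _ _ 1 _
    gap∈⟨⟩⇔ (inj₁ I) = inner-gap∈⟨⟩⇔ I p<m s<m
    gap∈⟨⟩⇔ (inj₂ L) = last-gap∈⟨⟩⇔ L p<m s<m

  at∈[]⇔ : ∀ {κ t x p s} → t < m → p < m → s < m → At κ t x →
           x ∈[ y p , y s ] ⇔ weight κ + offset p t ≤ offset p s
  at∈[]⇔ {point} t<m p<m s<m refl = ⇔-trans (y∈[]⇔ t<m p<m s<m) (between⇔offset z≤n p<m s<m t<m)
  at∈[]⇔ {gap}   t<m p<m s<m G    = ⇔-trans (gap∈[]⇔ G p<m s<m) (between⇔offset ≤-refl p<m s<m t<m)

  gap⇔∈⟨⟩ : ∀ {g v} → 1 < m → g < m → Gap g v ⇔ v ∈⟨ y g , y (g ⊕ 1) ⟩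
  gap⇔∈⟨⟩ {g} {v} 1<m g<m with m≤n⇒m<n∨m≡n g<m
  ... | inj₁ 1+g<m = subst (λ z → Gap g v ⇔ v ∈⟨ y g , y z ⟩) (sym g⊕1≡1+g) (mk⇔ to from)
    where
    g⊕1≡1+g : g ⊕ 1 ≡ suc g
    g⊕1≡1+g = trans (cong (_% m) (+-comm g 1)) (m<n⇒m%n≡m 1+g<m)
    to : Gap g v → v ∈⟨ y g , y (suc g) ⟩
    to (inj₁ (_ , yg<v , v<y[1+g])) = inj₁ (yg<v , v<y[1+g])
    to (inj₂ (1+g≡m , _))           = ⊥-elim (<-irrefl 1+g≡m 1+g<m)
    from : v ∈⟨ y g , y (suc g) ⟩ → Gap g v
    from (inj₁ (yg<v , v<y[1+g])) = inj₁ (1+g<m , yg<v , v<y[1+g])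
    from (inj₂ (y[1+g]<yg , _))   = ⊥-elim (<-asym y[1+g]<yg (y-mono-< (n<1+n g) 1+g<m))
  ... | inj₂ 1+g≡m = subst (λ z → Gap g v ⇔ v ∈⟨ y g , y z ⟩) (sym g⊕1≡0) (mk⇔ to from)
    where
    g⊕1≡0 : g ⊕ 1 ≡ 0
    g⊕1≡0 = trans (cong (_% m) (trans (+-comm g 1) 1+g≡m)) (n%n≡0 m)
    y0<yg : toℕ (y 0) < toℕ (y g)
    y0<yg = y-mono-< (s≤s⁻¹ (subst (1 <_) (sym 1+g≡m) 1<m)) g<m
    to : Gap g v → v ∈⟨ y g , y 0 ⟩
    to (inj₁ (1+g<m , _))  = ⊥-elim (<-irrefl 1+g≡m 1+g<m)
    to (inj₂ (_ , side))   = inj₂ (y0<yg , side)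
    from : v ∈⟨ y g , y 0 ⟩ → Gap g v
    from (inj₁ (yg<v , v<y0)) = ⊥-elim (<-asym y0<yg (<-trans yg<v v<y0))
    from (inj₂ (_ , side))    = inj₂ (1+g≡m , side)

module _ {n : ℕ} where

  sortPair : Fin n → Fin n → Fin n × Fin n
  sortPair a b with toℕ a <? toℕ b
  ... | yes _ = a , b
  ... | no _  = b , a

  sortPair-elim : ∀ (P : Fin n → Fin n → Set) {a b} → P a b → P b a →
                  P (proj₁ (sortPair a b)) (proj₂ (sortPair a b))
  sortPair-elim P {a} {b} Pab Pba with toℕ a <? toℕ b
  ... | yes _ = Pab
  ... | no _  = Pba

  sortPair-increasing : ∀ {a b} → a ≢ b → toℕ (proj₁ (sortPair a b)) < toℕ (proj₂ (sortPair a b))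
  sortPair-increasing {a} {b} a≢b with toℕ a <? toℕ b
  ... | yes a<b = a<b
  ... | no a≮b  = ≤∧≢⇒< (≮⇒≥ a≮b) (a≢b ∘ sym ∘ toℕ-injective)

  sortPair-injective : ∀ {a b c d} → sortPair a b ≡ sortPair c d → (a ≡ c × b ≡ d) ⊎ (a ≡ d × b ≡ c)
  sortPair-injective {a} {b} {c} {d} eq with toℕ a <? toℕ b | toℕ c <? toℕ d
  ... | yes _ | yes _ = inj₁ (cong proj₁ eq , cong proj₂ eq)
  ... | yes _ | no _  = inj₂ (cong proj₁ eq , cong proj₂ eq)
  ... | no _  | yes _ = inj₂ (cong proj₂ eq , cong proj₁ eq)
  ... | no _  | no _  = inj₁ (cong proj₂ eq , cong proj₁ eq)

  sortPair-< : ∀ {a b} → toℕ a < toℕ b → sortPair a b ≡ (a , b)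
  sortPair-< {a} {b} a<b with toℕ a <? toℕ b
  ... | yes _  = refl
  ... | no a≮b = ⊥-elim (a≮b a<b)

  sortPair-> : ∀ {a b} → toℕ a < toℕ b → sortPair b a ≡ (a , b)
  sortPair-> {a} {b} a<b with toℕ b <? toℕ a
  ... | yes b<a = ⊥-elim (<-asym a<b b<a)
  ... | no _    = refl

module Configuration {n : ℕ} (ℓ : ℕ) (1≤ℓ : 1 ≤ ℓ) (w : Fin (suc (2 * ℓ)) → Fin n) (r : ℕ)
  (chain : ∀ i j → i < j → j < suc (2 * ℓ) →
           toℕ (W ℓ w (suc (2 * ((r + i) % suc (2 * ℓ))))) < toℕ (W ℓ w (suc (2 * ((r + j) % suc (2 * ℓ))))))
  where

  open OddCycle ℓ 1≤ℓ

  y : ℕ → Fin n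
  y i = W ℓ w (suc (2 * ((r + i) % 2ℓ+1)))

  open SortedPoints 2ℓ+1 y chain

  W-cong : ∀ {a b} → a % 2ℓ+1 ≡ b % 2ℓ+1 → W ℓ w a ≡ W ℓ w b
  W-cong {a} {b} a≈b = cong w (fromℕ<-cong (a % 2ℓ+1) (b % 2ℓ+1) a≈b (m%n<n a 2ℓ+1) (m%n<n b 2ℓ+1))

  -- w_k = y (pos k): since 2(ℓ + 1) ≡ 1, the number (k + 2ℓ)(ℓ + 1) is (k − 1)/2 modulo 2ℓ+1.
  pos : ℕ → ℕ
  pos k = offset (r % 2ℓ+1) ((k + 2 * ℓ) * suc ℓ)

  pos<2ℓ+1 : ∀ k → pos k < 2ℓ+1
  pos<2ℓ+1 k = offset<m (r % 2ℓ+1) ((k + 2 * ℓ) * suc ℓ)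

  W≡y∘pos : ∀ k → W ℓ w k ≡ y (pos k)
  W≡y∘pos k = W-cong {k} {1 + 2 * ((r + pos k) % 2ℓ+1)} (begin
    k % 2ℓ+1                               ≡⟨ [m+kn]%n≡m%n k (suc (k + 2 * ℓ)) 2ℓ+1 ⟨
    (k + suc (k + 2 * ℓ) * 2ℓ+1) % 2ℓ+1    ≡⟨ cong (_% 2ℓ+1) (odd-double k ℓ) ⟨
    (1 + 2 * h) % 2ℓ+1                     ≡⟨ [m+n%d]%d≡[m+n]%d 1 (2 * h) 2ℓ+1 ⟨
    (1 + (2 * h) % 2ℓ+1) % 2ℓ+1            ≡⟨ cong (λ z → (1 + z) % 2ℓ+1) ([m*[n%d]]%d≡[m*n]%d 2 h 2ℓ+1) ⟨
    (1 + (2 * (h % 2ℓ+1)) % 2ℓ+1) % 2ℓ+1   ≡⟨ [m+n%d]%d≡[m+n]%d 1 (2 * (h % 2ℓ+1)) 2ℓ+1 ⟩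
    (1 + 2 * (h % 2ℓ+1)) % 2ℓ+1            ≡⟨ cong (λ z → (1 + 2 * z) % 2ℓ+1) r+pos≈h ⟨
    (1 + 2 * ((r + pos k) % 2ℓ+1)) % 2ℓ+1  ∎)
    where
    open ≡-Reasoning
    h = (k + 2 * ℓ) * suc ℓ
    r+pos≈h : (r + pos k) % 2ℓ+1 ≡ h % 2ℓ+1
    r+pos≈h = trans (sym ([m%d+n]%d≡[m+n]%d r (pos k) 2ℓ+1)) (offset-spec h (<⇒≤ (m%n<n r 2ℓ+1)))
    odd-double : ∀ k ℓ → 1 + 2 * ((k + 2 * ℓ) * suc ℓ) ≡ k + suc (k + 2 * ℓ) * suc (2 * ℓ)
    odd-double = Solver.solve-∀

  pos-suc : ∀ k → pos (suc k) ≡ pos k ⊕ suc ℓ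
  pos-suc k = trans (cong (offset (r % 2ℓ+1)) (+-comm (suc ℓ) _))
                    (offset-+ʳ ((k + 2 * ℓ) * suc ℓ) (suc ℓ) (<⇒≤ (m%n<n r 2ℓ+1)))

  pos≡pos∘suc⊕ℓ : ∀ k → pos k ≡ pos (suc k) ⊕ ℓ
  pos≡pos∘suc⊕ℓ k = sym (trans (cong (_⊕ ℓ) (pos-suc k)) (⊕[1+ℓ]⊕ℓ (pos<2ℓ+1 k)))

  W≡y∘pos∘suc⊕ℓ : ∀ k → W ℓ w k ≡ y (pos (suc k) ⊕ ℓ)
  W≡y∘pos∘suc⊕ℓ k = trans (W≡y∘pos k) (cong y (pos≡pos∘suc⊕ℓ k))

  pos∘suc-surjective : ∀ {q} → q < 2ℓ+1 → Σ ℕ λ i → i < 2ℓ+1 × pos (suc i) ≡ q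
  pos∘suc-surjective {q} q< = i , m%n<n 2j 2ℓ+1 , y-injective (pos<2ℓ+1 (suc i)) q<
    (trans (sym (W≡y∘pos (suc i))) (W-cong {suc i} {1 + 2j} ([m+n%d]%d≡[m+n]%d 1 2j 2ℓ+1)))
    where
    2j = 2 * ((r + q) % 2ℓ+1)
    i  = 2j % 2ℓ+1

  -- The arcs [w_(k+1), w_k] from the definition of H, indexed by the position q of w_(k+1).
  InArc : ℕ → Fin n → Set
  InArc q x = x ∈[ y q , y (q ⊕ ℓ) ]

  MeetsAllArcs : Fin n → Fin n → Set
  MeetsAllArcs a b = ∀ q → q < 2ℓ+1 → InArc q a ⊎ InArc q b

  ∈[W,W]≡InArc : ∀ k x → (x ∈[ W ℓ w (suc k) , W ℓ w k ]) ≡ InArc (pos (suc k)) x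
  ∈[W,W]≡InArc k x = cong₂ (λ u v → x ∈[ u , v ]) (W≡y∘pos (suc k)) (W≡y∘pos∘suc⊕ℓ k)

  InH2⇔meetsAllArcs : ∀ {a b} → InH2 ℓ w a b ⇔ (a ≢ b × MeetsAllArcs a b)
  InH2⇔meetsAllArcs {a} {b} = mk⇔ to from
    where
    to : InH2 ℓ w a b → a ≢ b × MeetsAllArcs a b
    to (a≢b , meets) = a≢b , λ q q< →
      let (k , k< , pos≡q) = pos∘suc-surjective q< in
      subst (λ q → InArc q a ⊎ InArc q b) pos≡q
            (subst₂ _⊎_ (∈[W,W]≡InArc k a) (∈[W,W]≡InArc k b) (meets (suc k) (s≤s z≤n) k<))
    from : a ≢ b × MeetsAllArcs a b → InH2 ℓ w a b
    from (a≢b , meets) = a≢b , λ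
      { (suc k) _ _ → subst₂ _⊎_ (sym (∈[W,W]≡InArc k a)) (sym (∈[W,W]≡InArc k b))
                                 (meets (pos (suc k)) (pos<2ℓ+1 (suc k))) }

  at-InArc⇔ : ∀ {κ t x q} → t < 2ℓ+1 → q < 2ℓ+1 → At κ t x →
              InArc q x ⇔ weight κ + offset q t ≤ ℓ
  at-InArc⇔ {κ} {t} {x} {q} t< q< at = subst (λ e → InArc q x ⇔ weight κ + offset q t ≤ e)
    (offset-⊕ℓ (<⇒≤ q<)) (at∈[]⇔ t< q< (m%n<n (q + ℓ) 2ℓ+1) at)

  partner : Fin n → Fin n
  partner x = y (Location.index (locate x) ⊕ suc ℓ)

  partner-at : ∀ {κ t x} → t < 2ℓ+1 → At κ t x → partner x ≡ y (t ⊕ suc ℓ)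
  partner-at {x = x} t< at with locate x
  ... | location _ _ t'< at' = cong (λ i → y (i ⊕ suc ℓ)) (proj₂ (at-unique t'< t< at' at))

  partner≢ : ∀ x → partner x ≢ x
  partner≢ x with locate x
  ... | location κ t t< at = λ t⊕1+ℓ≡x →
    ⊕[1+ℓ]≢ t< (proj₂ (at-unique (m%n<n (t + suc ℓ) 2ℓ+1) t< (sym t⊕1+ℓ≡x) at))

  partner²≢ : ∀ x → partner (partner x) ≢ x
  partner²≢ x with locate x
  ... | location κ t t< at = λ p²x≡x →
    ⊕1≢ t< (trans (sym (⊕[1+ℓ]⊕[1+ℓ] t)) (proj₂ (at-unique t''< t< (sym (trans (sym p²x≡y) p²x≡x)) at)))
    where
    t'< = m%n<n (t + suc ℓ) 2ℓ+1
    t''< = m%n<n (t ⊕ suc ℓ + suc ℓ) 2ℓ+1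
    p²x≡y : partner (y (t ⊕ suc ℓ)) ≡ y (t ⊕ suc ℓ ⊕ suc ℓ)
    p²x≡y = partner-at t'< refl

  partner-meetsAllArcs : ∀ x → MeetsAllArcs x (partner x)
  partner-meetsAllArcs x q q< with locate x
  ... | location κ t t< at with offset-covers t (<⇒≤ q<)
  ...   | inj₁ near = inj₁ (Equivalence.from (at-InArc⇔ t< q< at)
                              (≤-trans (+-monoˡ-≤ (offset q t) (weight≤1 κ)) near))
  ...   | inj₂ far  = inj₂ (Equivalence.from (at-InArc⇔ (m%n<n (t + suc ℓ) 2ℓ+1) q< refl) far)

  Partners : Fin n → Fin n → Set
  Partners a b = b ≡ partner a ⊎ a ≡ partner b

  -- The arcs starting 1 and weight κ + ℓ places after a's location miss a, so b lies in both.
  meetsAllArcs⇒partners : ∀ {a b} → MeetsAllArcs a b → Partners a b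
  meetsAllArcs⇒partners {a} {b} meets = go (locate a) (locate b)
    where
    go : Location a → Location b → Partners a b
    go (location κ s s< atᵃ) (location μ t t< atᵇ) =
      conclude (meeting-offset κ μ (offset<m s t) (b∈ 1 ≤-refl 1≤κ+ℓ) (b∈ (weight κ + ℓ) 1≤κ+ℓ ≤-refl))
      where
      1≤κ+ℓ : 1 ≤ weight κ + ℓ
      1≤κ+ℓ = ≤-trans 1≤ℓ (m≤n+m ℓ (weight κ))
      b∈ : ∀ c → 1 ≤ c → c ≤ weight κ + ℓ → weight μ + offset c (offset s t) ≤ ℓ
      b∈ c 1≤c c≤κ+ℓ = subst (λ e → weight μ + e ≤ ℓ) (shift t)
        (Equivalence.to (at-InArc⇔ t< q< atᵇ) (fromInj₂ (⊥-elim ∘ a∉) (meets (s ⊕ c) q<)))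
        where
        q< = m%n<n (s + c) 2ℓ+1
        shift : ∀ z → offset (s ⊕ c) z ≡ offset c (offset s z)
        shift z = offset-⊕ˡ z (<⇒≤ s<) (≤-trans c≤κ+ℓ (<⇒≤ (κ+ℓ<2ℓ+1 (weight≤1 κ))))
        a∉ : ¬ InArc (s ⊕ c) a
        a∉ a∈ = κ+offset[c,0]≰ℓ (weight≤1 κ) 1≤c c≤κ+ℓ
          (subst (λ e → weight κ + e ≤ ℓ) (trans (shift s) (cong (offset c) (offset-self (<⇒≤ s<))))
                 (Equivalence.to (at-InArc⇔ s< q< atᵃ) a∈))
      t≡s⊕ : ∀ {c} → offset s t ≡ c → t ≡ s ⊕ c
      t≡s⊕ offset≡c = trans (sym (⊕-offset (<⇒≤ s<) t<)) (cong (s ⊕_) offset≡c)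
      conclude : (offset s t ≡ suc ℓ × μ ≡ point) ⊎ (offset s t ≡ ℓ × κ ≡ point) → Partners a b
      conclude (inj₁ (offset≡1+ℓ , μ≡point)) = inj₁ (begin
        b                ≡⟨ subst (λ k → At k t b) μ≡point atᵇ ⟩
        y t              ≡⟨ cong y (t≡s⊕ offset≡1+ℓ) ⟩
        y (s ⊕ suc ℓ)    ≡⟨ partner-at s< atᵃ ⟨
        partner a        ∎)
        where open ≡-Reasoning
      conclude (inj₂ (offset≡ℓ , κ≡point)) = inj₂ (begin
        a                  ≡⟨ subst (λ k → At k s a) κ≡point atᵃ ⟩
        y s                ≡⟨ cong y (⊕ℓ⊕[1+ℓ] s<) ⟨
        y (s ⊕ ℓ ⊕ suc ℓ)  ≡⟨ cong (λ z → y (z ⊕ suc ℓ)) (t≡s⊕ offset≡ℓ) ⟨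
        y (t ⊕ suc ℓ)      ≡⟨ partner-at t< atᵇ ⟨
        partner b          ∎)
        where open ≡-Reasoning

  partners⇒InH2 : ∀ {a b} → Partners a b → InH2 ℓ w a b
  partners⇒InH2 {a} (inj₁ refl) =
    Equivalence.from InH2⇔meetsAllArcs (partner≢ a ∘ sym , partner-meetsAllArcs a)
  partners⇒InH2 {b = b} (inj₂ refl) =
    Equivalence.from InH2⇔meetsAllArcs (partner≢ b , λ q q< → swap (partner-meetsAllArcs b q q<))

  InH2⇔partners : ∀ {a b} → InH2 ℓ w a b ⇔ Partners a b
  InH2⇔partners = mk⇔ (meetsAllArcs⇒partners ∘ proj₂ ∘ Equivalence.to InH2⇔meetsAllArcs) partners⇒InH2

  partner-at-pos : ∀ {κ k x} → At κ (pos k) x → partner x ≡ W ℓ w (suc k)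
  partner-at-pos {k = k} at =
    trans (partner-at (pos<2ℓ+1 k) at) (trans (cong y (sym (pos-suc k))) (sym (W≡y∘pos (suc k))))

  ∈⟨W,W⟩⇔gap : ∀ k v → v ∈⟨ W ℓ w k , W ℓ w (suc (suc k)) ⟩ ⇔ Gap (pos k) v
  ∈⟨W,W⟩⇔gap k v = subst₂ (λ u z → v ∈⟨ u , z ⟩ ⇔ Gap (pos k) v) (sym (W≡y∘pos k)) (sym W[2+k]≡y)
                          (⇔-sym (gap⇔∈⟨⟩ (≤-<-trans 1≤ℓ ℓ<2ℓ+1) (pos<2ℓ+1 k)))
    where
    W[2+k]≡y : W ℓ w (suc (suc k)) ≡ y (pos k ⊕ 1)
    W[2+k]≡y = trans (W≡y∘pos (suc (suc k)))
      (cong y (trans (pos-suc (suc k)) (trans (cong (_⊕ suc ℓ) (pos-suc k)) (⊕[1+ℓ]⊕[1+ℓ] (pos k)))))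

  samePair⇒partners : ∀ {a b z} → SamePair ℓ w a b z (partner z) → Partners a b
  samePair⇒partners (inj₁ (refl , refl)) = inj₁ refl
  samePair⇒partners (inj₂ (refl , refl)) = inj₂ refl

  claimedEdge⇒partners : ∀ {a b} → ClaimedEdge ℓ w a b → Partners a b
  claimedEdge⇒partners {a} {b} (inj₁ (k , _ , _ , same)) =
    samePair⇒partners (subst (SamePair ℓ w a b (W ℓ w k)) (sym (partner-at-pos (W≡y∘pos k))) same)
  claimedEdge⇒partners {a} {b} (inj₂ (suc k , _ , _ , v , v∈ , same)) =
    samePair⇒partners (subst (SamePair ℓ w a b v) (sym (partner-at-pos v-in-gap)) same)
    where v-in-gap = Equivalence.to (∈⟨W,W⟩⇔gap k v) v∈

  claimedEdge-partner : ∀ x → ClaimedEdge ℓ w x (partner x)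
  claimedEdge-partner x = go (locate x)
    where
    go : Location x → ClaimedEdge ℓ w x (partner x)
    go (location point t t< x≡yt) with pos∘suc-surjective t<
    ... | k , k< , refl =
      inj₁ (suc k , s≤s z≤n , k< , inj₁ (trans x≡yt (sym (W≡y∘pos (suc k))) , partner-at-pos {point} x≡yt))
    go (location gap t t< G) with pos∘suc-surjective (m%n<n (t + suc ℓ) 2ℓ+1)
    ... | k , k< , pos[1+k]≡t⊕1+ℓ =
      inj₂ (suc k , s≤s z≤n , k< , x , Equivalence.from (∈⟨W,W⟩⇔gap k x) G' ,
            inj₁ (refl , partner-at-pos {gap} G'))
      where
      pos≡t : pos k ≡ t
      pos≡t = trans (pos≡pos∘suc⊕ℓ k) (trans (cong (_⊕ ℓ) pos[1+k]≡t⊕1+ℓ) (⊕[1+ℓ]⊕ℓ t<))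
      G' : Gap (pos k) x
      G' = subst (λ g → Gap g x) (sym pos≡t) G

  samePair-sym : ∀ {a b x z} → SamePair ℓ w a b x z → SamePair ℓ w b a x z
  samePair-sym (inj₁ (a≡x , b≡z)) = inj₂ (b≡z , a≡x)
  samePair-sym (inj₂ (a≡z , b≡x)) = inj₁ (b≡x , a≡z)

  claimedEdge-sym : ∀ {a b} → ClaimedEdge ℓ w a b → ClaimedEdge ℓ w b a
  claimedEdge-sym (inj₁ (i , 1≤i , i≤ , same)) = inj₁ (i , 1≤i , i≤ , samePair-sym same)
  claimedEdge-sym (inj₂ (i , 1≤i , i≤ , v , v∈ , same)) =
    inj₂ (i , 1≤i , i≤ , v , v∈ , samePair-sym same)

  ClaimedEdge⇔partners : ∀ {a b} → ClaimedEdge ℓ w a b ⇔ Partners a b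
  ClaimedEdge⇔partners {a} {b} = mk⇔ claimedEdge⇒partners λ
    { (inj₁ refl) → claimedEdge-partner a
    ; (inj₂ refl) → claimedEdge-sym (claimedEdge-partner b) }

  edge : Fin n → Fin n × Fin n
  edge x = sortPair x (partner x)

  edges : List (Fin n × Fin n)
  edges = map edge (allFin n)

  edges-unique : Unique edges
  edges-unique = UniqueP.map⁺ edge-injective (UniqueP.allFin⁺ n)
    where
    edge-injective : ∀ {x x'} → edge x ≡ edge x' → x ≡ x'
    edge-injective {x} eq with sortPair-injective eq
    ... | inj₁ (x≡x' , _)       = x≡x'
    ... | inj₂ (x≡px' , px≡x') = ⊥-elim (partner²≢ x (trans (cong partner px≡x') (sym x≡px')))

  edges-valid : All (λ e → toℕ (proj₁ e) < toℕ (proj₂ e) × InH2 ℓ w (proj₁ e) (proj₂ e)) edges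
  edges-valid = AllP.map⁺ (All.tabulate λ {x} _ →
    sortPair-increasing (partner≢ x ∘ sym) ,
    sortPair-elim (InH2 ℓ w) (partners⇒InH2 (inj₁ refl)) (partners⇒InH2 (inj₂ refl)))

  edges-complete : ∀ a b → toℕ a < toℕ b → InH2 ℓ w a b → (a , b) ∈ edges
  edges-complete a b a<b h = edge∈ (Equivalence.to InH2⇔partners h)
    where
    edge∈ : Partners a b → (a , b) ∈ edges
    edge∈ (inj₁ b≡pa) = subst (_∈ edges) (trans (cong (sortPair a) (sym b≡pa)) (sortPair-< a<b))
                              (∈-map⁺ edge (∈-allFin a))
    edge∈ (inj₂ a≡pb) = subst (_∈ edges) (trans (cong (sortPair b) (sym a≡pb)) (sortPair-> a<b))
                              (∈-map⁺ edge (∈-allFin b))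

  edges-length : length edges ≡ n
  edges-length = trans (length-map edge (allFin n)) (length-tabulate id)

lemma3p1 : (n ℓ : ℕ) → 1 ≤ ℓ → (w : Fin (suc (2 * ℓ)) → Fin n) →
    Injective _≡_ _≡_ w →
    IsCyclicChain (suc (2 * ℓ)) (λ j → W ℓ w (suc (2 * j))) →
    ((a b : Fin n) → InH2 ℓ w a b ⇔ ClaimedEdge ℓ w a b)
    × (Σ (List (Fin n × Fin n)) λ E →
         Unique E
         × All (λ e → toℕ (proj₁ e) < toℕ (proj₂ e)
                      × InH2 ℓ w (proj₁ e) (proj₂ e)) E
         × ((a b : Fin n) → toℕ a < toℕ b → InH2 ℓ w a b → (a , b) ∈ E)
         × length E ≡ n)
lemma3p1 n ℓ 1≤ℓ w _ (r , chain) =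
  (λ a b → ⇔-trans InH2⇔partners (⇔-sym ClaimedEdge⇔partners)) ,
  edges , edges-unique , edges-valid , edges-complete , edges-length
  where open Configuration ℓ 1≤ℓ w r chain
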